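{- Let $x,y$ be two distinct vertices of $C$ and let $P_1,P_2$ be the two $(x,y)$-paths in $C$. Let $Q$ be a $(Z_x,Z_y)$-path in $G_{nbd}$ such that $\mathsf{sp}(Q)\neq V(C)$. Then $V(Q)\subseteq Z_{V(P_1)}$ or $V(Q)\subseteq Z_{V(P_2)}$.
   Context: Graphs are finite and simple. A hole is an induced cycle of length at least $4$; a graph is chordal if it has no hole. Let $s_k=4k(\log k+\log\log k+4)$ for $k\ge2$, $s_1=2$, and $\mu_k=76s_{k+1}+3217k+1985$. Standing assumptions: $G$ is a graph, $k$ a positive integer, $C$ a shortest hole of $G$ of length strictly greater than $\mu_k$, and $G-V(C)$ is chordal. $D$ is the set of vertices of $G$ adjacent to every vertex of $C$; $G_{nbd}=G[N[V(C)]\setminus D]$. For $v\in V(C)$, $Z_v=\{v\}\cup(N(v)\setminus V(C)\setminus D)$, and $Z_S=\bigcup_{v\in S}Z_v$ for $S\subseteq V(C)$. For a subgraph $H$, $\mathsf{sp}(H)$ is the set of $v\in V(C)$ with $(Z_v\cup D)\cap V(H)\neq\emptyset$. For vertex sets $A,B$, an $(A,B)$-path is a path $v_0\cdots v_\ell$ with $v_0\in A$, $v_\ell\in B$ and all internal vertices outside $A\cup B$. -}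

module Defs where

open import Data.Nat as ℕ using (ℕ; zero; suc; _≤ᵇ_; _!)

open import Data.Fin using (Fin; toℕ; inject₁)
import Data.Fin
open import Data.Integer as ℤ using (ℤ; +_)
open import Data.Rational.Unnormalised as Q
  using (ℚᵘ; mkℚᵘ; 0ℚᵘ; 1ℚᵘ)
open import Data.Bool using (if_then_else_)
open import Data.Product using (Σ; ∃; _×_)
open import Data.Sum using (_⊎_)
open import Relation.Nullary using (¬_; Dec)
open import Relation.Binary.PropositionalEquality using (_≡_; _≢_)

record Graph : Set₁ where
  field
    n      : ℕ
    _~_    : Fin n → Fin n → Set
    ~-sym  : ∀ {u v} → u ~ v → v ~ u
    ~-irr  : ∀ {v} → ¬ (v ~ v)
    ~-dec  : ∀ u v → Dec (u ~ v)

open Graph public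

Vtx : Graph → Set
Vtx G = Fin (n G)

CycAdj : (L : ℕ) → Fin L → Fin L → Set
CycAdj L i j =
     suc (toℕ i) ≡ toℕ j
  ⊎ (suc (toℕ j) ≡ toℕ i
  ⊎ ((toℕ i ≡ 0 × suc (toℕ j) ≡ L)
  ⊎  (toℕ j ≡ 0 × suc (toℕ i) ≡ L)))

Injective : ∀ {A B : Set} → (A → B) → Set
Injective f = ∀ {a b} → f a ≡ f b → a ≡ b

record IsHole (G : Graph) (L : ℕ) (c : Fin L → Vtx G) : Set where
  field
    len≥4  : 4 ℕ.≤ L
    inj    : Injective c
    adj⇒   : ∀ i j → _~_ G (c i) (c j) → CycAdj L i j
    ⇒adj   : ∀ i j → CycAdj L i j → _~_ G (c i) (c j)

-- A hole of the induced subgraph G[S] (S a set of vertices):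
-- a hole of G all of whose vertices lie in S.
HoleIn : (G : Graph) → (Vtx G → Set) → Set
HoleIn G S = Σ ℕ λ L → Σ (Fin L → Vtx G) λ c → IsHole G L c × (∀ i → S (c i))

ChordalOn : (G : Graph) → (Vtx G → Set) → Set
ChordalOn G S = ¬ HoleIn G S

IsShortestHole : (G : Graph) (L : ℕ) (c : Fin L → Vtx G) → Set
IsShortestHole G L c =
  IsHole G L c × (∀ L' (c' : Fin L' → Vtx G) → IsHole G L' c' → L ℕ.≤ L')

-- The threshold μ_k = 76 s_{k+1} + 3217k + 1985, with
-- s_m = 4m(ln m + ln ln m + 4) (m = k+1 ≥ 2), as a real number.
-- "μ_k < L" is expressed through exact rational/exponential criteria:
--   μ_k < L  ⇔  with m = k+1, R = L - 3217k - 1985, r = R/(304 m),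
--               r ≥ 4 and ∃ b ∈ ℚ, b ≥ 0, m·b < exp(r-4), m < exp b.

powQ : ℚᵘ → ℕ → ℚᵘ
powQ x zero    = 1ℚᵘ
powQ x (suc k) = x Q.* powQ x k

-- 1 / n!
invFact : ℕ → ℚᵘ
invFact k = mkℚᵘ (+ 1) ((k !) ℕ.∸ 1)

expPartial : ℚᵘ → ℕ → ℚᵘ
expPartial x zero    = 0ℚᵘ
expPartial x (suc N) = expPartial x N Q.+ (powQ x N Q.* invFact N)

-- y < exp x, for x ≥ 0 (partial sums increase to exp x)
_<exp_ : ℚᵘ → ℚᵘ → Set
y <exp x = ∃ λ N → y Q.< expPartial x N

ℕtoℚ : ℕ → ℚᵘ
ℕtoℚ m = mkℚᵘ (+ m) 0

MuLt : ℕ → ℕ → Set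
MuLt k L =
  let m  = suc k
      R  = (+ L) ℤ.- (+ (3217 ℕ.* k ℕ.+ 1985))
      x  = mkℚᵘ (R ℤ.- (+ (1216 ℕ.* m))) (304 ℕ.* m ℕ.∸ 1)   -- x = r - 4
  in (+ (1216 ℕ.* m)) ℤ.≤ R
     × Σ ℚᵘ λ b → 0ℚᵘ Q.≤ b
                 × ((ℕtoℚ m Q.* b) <exp x)
                 × (ℕtoℚ m <exp b)

module _ (G : Graph) {L : ℕ} (c : Fin L → Vtx G) where

  InC : Vtx G → Set
  InC v = ∃ λ i → c i ≡ v

  InD : Vtx G → Set
  InD v = ∀ i → _~_ G v (c i)

  -- N[V(C)] \ D : vertex set of G_nbd
  InNbd : Vtx G → Set
  InNbd v = (InC v ⊎ (∃ λ i → _~_ G v (c i))) × ¬ InD v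

  Z : Fin L → Vtx G → Set
  Z i u = u ≡ c i ⊎ (_~_ G u (c i) × ¬ InC u × ¬ InD u)

  -- Z_S for S ⊆ V(C) (given as a predicate on positions)
  ZS : (Fin L → Set) → Vtx G → Set
  ZS S u = ∃ λ i → S i × Z i u

fwd : (L : ℕ) → Fin L → Fin L → ℕ
fwd L a i = if toℕ a ≤ᵇ toℕ i then toℕ i ℕ.∸ toℕ a
            else (toℕ i ℕ.+ L) ℕ.∸ toℕ a

-- positions on the (x,y)-path of C obtained by walking forward from
-- position a to position b  (the two (x,y)-paths of C are Arc a b and Arc b a)
Arc : (L : ℕ) → Fin L → Fin L → Fin L → Set
Arc L a b i = fwd L a i ℕ.≤ fwd L a b

record IsPath (G : Graph) (ℓ : ℕ) (q : Fin (suc ℓ) → Vtx G) : Set where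
  field
    inj  : Injective q
    adj  : ∀ (j : Fin ℓ) → _~_ G (q (inject₁ j)) (q (Data.Fin.suc j))

IsABPath : (G : Graph) (A B : Vtx G → Set) (ℓ : ℕ) (q : Fin (suc ℓ) → Vtx G) → Set
IsABPath G A B ℓ q =
  IsPath G ℓ q
  × A (q Data.Fin.zero)
  × B (q (Data.Fin.fromℕ ℓ))
  × (∀ j → 0 ℕ.< toℕ j → toℕ j ℕ.< ℓ → ¬ A (q j) × ¬ B (q j))

{-# OPTIONS --safe #-}
module Submission where

-- Fix a vertex m of C whose Z-set misses Q (one exists as sp(Q) ≠ V(C)) and read C linearly
-- starting from m.  The key fact: there is no edge uv with u ∈ Z_α, v ∈ Z_β, u, v ∉ Z_γ ∪ Z_m
-- when γ and m separate α from β on C.  Otherwise u or v is off C, and it (or the edge uv)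
-- touches both arcs of C between α and β; cutting either arc down to its last contacts gives a
-- hole of length at most the arc length + 2 (+ 3 for an edge).  The two arcs have total length L
-- and no hole is shorter than L, so L ≤ 4 (L ≤ 6); for an edge the vertex case first shows that
-- u and v have no common neighbour on C.  Hence the interior vertices of Q all lie in Z-sets of
-- one open side of {a, b}.

open import Defs
open import Data.Bool using (true; false; if_then_else_)
open import Data.Empty using (⊥; ⊥-elim)
open import Data.Fin as Fin using (Fin; toℕ; fromℕ<)
open import Data.Fin.Properties
  using (toℕ-injective; toℕ<n; toℕ-fromℕ<; toℕ-fromℕ; toℕ-inject₁; any?; all?; ¬∀⟶∃¬)
import Data.Integer as ℤ
import Data.Integer.Properties as ℤ
open import Data.List using (_∷_; [])
open import Data.Nat
open import Data.Nat.DivMod using (_%_; _mod_; _/_; m<n⇒m%n≡m; [m+kn]%n≡m%n; m≡m%n+[m/n]*n)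
open import Data.Nat.Properties
open import Data.Nat.Tactic.RingSolver using (solve)
open import Data.Product using (∃; ∃₂; _×_; _,_; proj₁; proj₂)
import Data.Product
open import Data.Sum using (_⊎_; inj₁; inj₂)
import Data.Sum
open import Function.Base using (_∘_)
open import Function.Bundles using (_⇔_; mk⇔; Equivalence)
import Function.Properties.Equivalence as ⇔
open import Relation.Binary.Definitions using (tri<; tri≈; tri>)
open import Relation.Binary.PropositionalEquality
open import Relation.Nullary using (¬_; yes; no; contradiction; ¬?)
open import Relation.Nullary.Decidable using (_×-dec_; _⊎-dec_)
open import Relation.Nullary.Reflects using (ofʸ; ofⁿ)
open import Relation.Unary using (Decidable)

≤-of-common-offset : ∀ {a x y p q} → a + x ≡ p → a + y ≡ q → p ≤ q → x ≤ y
≤-of-common-offset {a} a+x≡p a+y≡q p≤q =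
  +-cancelˡ-≤ a _ _ (subst₂ _≤_ (sym a+x≡p) (sym a+y≡q) p≤q)

<-of-common-offset : ∀ {a x y p q} → a + x ≡ p → a + y ≡ q → p < q → x < y
<-of-common-offset {a} a+x≡p a+y≡q p<q =
  +-cancelˡ-< a _ _ (subst₂ _<_ (sym a+x≡p) (sym a+y≡q) p<q)

≤-halves : ∀ {a b k n} → a + b ≡ n → n ≤ k + a → n ≤ k + b → n ≤ k + k
≤-halves {a} {b} {k} {n} a+b≡n n≤k+a n≤k+b = +-cancelʳ-≤ n n (k + k) (begin
  n + n             ≤⟨ +-mono-≤ n≤k+a n≤k+b ⟩
  k + a + (k + b)   ≡⟨ solve (k ∷ a ∷ b ∷ []) ⟩
  k + k + (a + b)   ≡⟨ cong (k + k +_) a+b≡n ⟩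
  k + k + n         ∎)
  where open ≤-Reasoning

module _ {P : ℕ → Set} (P? : Decidable P) where

  greatest-witness : ∀ n → P 0 →
    ∃ λ x → x ≤ n × P x × (∀ z → x < z → z ≤ n → ¬ P z)
  greatest-witness zero    p₀ = 0 , z≤n , p₀ , λ z 0<z z≤0 → contradiction (<-≤-trans 0<z z≤0) n≮0
  greatest-witness (suc n) p₀ with P? (suc n)
  ... | yes pₙ = suc n , ≤-refl , pₙ , λ z n<z z≤n → contradiction (<-≤-trans n<z z≤n) (n≮n _)
  ... | no ¬pₙ with greatest-witness n p₀
  ...   | x , x≤n , pₓ , none-above = x , m≤n⇒m≤1+n x≤n , pₓ , none-above′
    where
      none-above′ : ∀ z → x < z → z ≤ suc n → ¬ P z
      none-above′ z x<z z≤1+n with m≤n⇒m<n∨m≡n z≤1+n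
      ... | inj₁ z<1+n = none-above z x<z (≤-pred z<1+n)
      ... | inj₂ refl  = ¬pₙ

  least-witness : ∀ {g y} → g ≤ y → P y →
    ∃ λ x → g ≤ x × x ≤ y × P x × (∀ z → g ≤ z → z < x → ¬ P z)
  least-witness {g} g≤y p with m≤n⇒∃[o]m+o≡n g≤y
  ... | k , refl = search g k p
    where
      search : ∀ g k → P (g + k) →
        ∃ λ x → g ≤ x × x ≤ g + k × P x × (∀ z → g ≤ z → z < x → ¬ P z)
      search g k p with P? g
      ... | yes pg = g , ≤-refl , m≤m+n g k , pg , λ z g≤z z<g → contradiction (≤-<-trans g≤z z<g) (n≮n _)
      search g zero    p | no ¬pg = contradiction (subst P (+-identityʳ g) p) ¬pg
      search g (suc k) p | no ¬pg with search (suc g) k (subst P (+-suc g k) p)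
      ... | x , g<x , x≤ , pₓ , none-below =
        x , <⇒≤ g<x , subst (x ≤_) (sym (+-suc g k)) x≤ , pₓ , none-below′
        where
          none-below′ : ∀ z → g ≤ z → z < x → ¬ P z
          none-below′ z g≤z z<x with m≤n⇒m<n∨m≡n g≤z
          ... | inj₁ g<z  = none-below z g<z z<x
          ... | inj₂ refl = ¬pg

module _ {P : ℕ → Set} {lo hi : ℕ} (step : ∀ t → lo ≤ t → suc t < hi → P t ⇔ P (suc t)) where

  private
    invariant-from-start : ∀ k → lo + k < hi → P lo ⇔ P (lo + k)
    invariant-from-start zero    _ = subst (λ t → P lo ⇔ P t) (sym (+-identityʳ lo)) ⇔.refl
    invariant-from-start (suc k) h = subst (λ t → P lo ⇔ P t) (sym (+-suc lo k))
      (⇔.trans (invariant-from-start k (<-trans (+-monoʳ-< lo (n<1+n k)) h))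
               (step (lo + k) (m≤m+n lo k) (subst (_< hi) (+-suc lo k) h)))

  invariant-on-interval : ∀ {i j} → lo ≤ i → i < hi → lo ≤ j → j < hi → P i → P j
  invariant-on-interval lo≤i i<hi lo≤j j<hi pᵢ with m≤n⇒∃[o]m+o≡n lo≤i | m≤n⇒∃[o]m+o≡n lo≤j
  ... | k , refl | k′ , refl =
    Equivalence.to (invariant-from-start k′ j<hi) (Equivalence.from (invariant-from-start k i<hi) pᵢ)

-- Induced paths and the holes they close

snoc : {A : Set} → ℕ → (ℕ → A) → A → ℕ → A
snoc n p v k = if k <ᵇ n then p k else v

snoc-view : {A : Set} {n k : ℕ} (p : ℕ → A) (v : A) → k < suc n →
  (k < n × snoc n p v k ≡ p k) ⊎ (k ≡ n × snoc n p v k ≡ v)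
snoc-view {n = n} {k} p v k<1+n with k <ᵇ n | <ᵇ-reflects-< k n
... | true  | ofʸ k<n = inj₁ (k<n , refl)
... | false | ofⁿ k≮n = inj₂ (≤-antisym (≤-pred k<1+n) (≮⇒≥ k≮n) , refl)

module _ (G : Graph) where

  open Graph G using () renaming (_~_ to _∼_)

  record IsInducedPath (len : ℕ) (p : ℕ → Vtx G) : Set where
    field
      injective : ∀ {i j} → i < len → j < len → p i ≡ p j → i ≡ j
      linked    : ∀ {i} → suc i < len → p i ∼ p (suc i)
      chordless : ∀ {i j} → i < len → j < len → p i ∼ p j → suc i ≡ j ⊎ suc j ≡ i

  segment : ∀ {len len′ p} x → x + len′ ≤ len → IsInducedPath len p →
    IsInducedPath len′ (λ z → p (x + z))
  segment {len} {len′} {p} x bound path = record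
    { injective = λ i< j< e → +-cancelˡ-≡ x _ _ (injective (shift i<) (shift j<) e)
    ; linked    = λ {i} 1+i< → subst (λ t → p (x + i) ∼ p t) (sym (+-suc x i))
                                 (linked (subst (_< len) (+-suc x i) (shift 1+i<)))
    ; chordless = λ {i} {j} i< j< a → Data.Sum.map
                    (λ e → +-cancelˡ-≡ x _ _ (trans (+-suc x i) e))
                    (λ e → +-cancelˡ-≡ x _ _ (trans (+-suc x j) e))
                    (chordless (shift i<) (shift j<) a)
    }
    where
      open IsInducedPath path
      shift : ∀ {i} → i < len′ → x + i < len
      shift i< = ≤-trans (+-monoʳ-< x i<) bound

  module _ {n : ℕ} {p : ℕ → Vtx G} {v : Vtx G} (path : IsInducedPath (suc n) p)
           (fresh : ∀ z → z < suc n → v ≢ p z) where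

    open IsInducedPath path

    private
      q : ℕ → Vtx G
      q = snoc (suc n) p v

    snoc-last : q (suc n) ≡ v
    snoc-last with snoc-view p v (n<1+n (suc n))
    ... | inj₁ (n<n , _) = contradiction n<n (n≮n _)
    ... | inj₂ (_ , e)   = e

    snoc-injective : ∀ {i j} → i < suc (suc n) → j < suc (suc n) → q i ≡ q j → i ≡ j
    snoc-injective {i} {j} i< j< e with snoc-view p v i< | snoc-view p v j<
    ... | inj₁ (i<′ , eᵢ) | inj₁ (j<′ , eⱼ) = injective i<′ j<′ (trans (sym eᵢ) (trans e eⱼ))
    ... | inj₁ (i<′ , eᵢ) | inj₂ (refl , eⱼ) =
      contradiction (trans (sym eⱼ) (trans (sym e) eᵢ)) (fresh i i<′)
    ... | inj₂ (refl , eᵢ) | inj₁ (j<′ , eⱼ) =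
      contradiction (trans (sym eᵢ) (trans e eⱼ)) (fresh j j<′)
    ... | inj₂ (refl , _) | inj₂ (refl , _) = refl

    snoc-adjacent : ∀ {i j} → i < suc (suc n) → j < suc (suc n) → q i ∼ q j →
      (suc i ≡ j ⊎ suc j ≡ i) ⊎ (i ≡ suc n × j < suc n × v ∼ p j ⊎ j ≡ suc n × i < suc n × v ∼ p i)
    snoc-adjacent {i} {j} i< j< a with snoc-view p v i< | snoc-view p v j<
    ... | inj₁ (i<′ , eᵢ) | inj₁ (j<′ , eⱼ) = inj₁ (chordless i<′ j<′ (subst₂ _∼_ eᵢ eⱼ a))
    ... | inj₁ (i<′ , eᵢ) | inj₂ (refl , eⱼ) =
      inj₂ (inj₂ (refl , i<′ , ~-sym G (subst₂ _∼_ eᵢ eⱼ a)))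
    ... | inj₂ (refl , eᵢ) | inj₁ (j<′ , eⱼ) = inj₂ (inj₁ (refl , j<′ , subst₂ _∼_ eᵢ eⱼ a))
    ... | inj₂ (refl , _) | inj₂ (refl , _) = contradiction a (~-irr G)

    snoc-linked : v ∼ p n → ∀ {i} → suc i < suc (suc n) → q i ∼ q (suc i)
    snoc-linked v∼pₙ {i} 1+i< with snoc-view p v (<-trans (n<1+n i) 1+i<) | snoc-view p v 1+i<
    ... | inj₁ (_ , eᵢ) | inj₁ (1+i<′ , e₁₊ᵢ) = subst₂ _∼_ (sym eᵢ) (sym e₁₊ᵢ) (linked 1+i<′)
    ... | inj₁ (_ , eᵢ) | inj₂ (refl , e₁₊ᵢ)  = subst₂ _∼_ (sym eᵢ) (sym e₁₊ᵢ) (~-sym G v∼pₙ)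
    ... | inj₂ (refl , _) | _ = contradiction 1+i< (n≮n _ ∘ ≤-trans (n<1+n _) ∘ ≤-pred)

    snoc-induced : v ∼ p n → (∀ z → z < suc n → v ∼ p z → z ≡ n) →
      IsInducedPath (suc (suc n)) q
    snoc-induced v∼pₙ only-last = record
      { injective = snoc-injective
      ; linked    = snoc-linked v∼pₙ
      ; chordless = chordless⁺
      }
      where
        chordless⁺ : ∀ {i j} → i < suc (suc n) → j < suc (suc n) → q i ∼ q j →
          suc i ≡ j ⊎ suc j ≡ i
        chordless⁺ i< j< a with snoc-adjacent i< j< a
        ... | inj₁ consecutive = consecutive
        ... | inj₂ (inj₁ (refl , j<′ , v∼pⱼ)) = inj₂ (cong suc (only-last _ j<′ v∼pⱼ))
        ... | inj₂ (inj₂ (refl , i<′ , v∼pᵢ)) = inj₁ (cong suc (only-last _ i<′ v∼pᵢ))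

    close-by-vertex : 2 ≤ n → v ∼ p 0 → v ∼ p n → (∀ z → z < suc n → v ∼ p z → z ≡ 0 ⊎ z ≡ n) →
      IsHole G (suc (suc n)) (q ∘ toℕ)
    close-by-vertex 2≤n v∼p₀ v∼pₙ only-ends = record
      { len≥4 = s≤s (s≤s 2≤n)
      ; inj   = λ {K} {K′} e → toℕ-injective (snoc-injective (toℕ<n K) (toℕ<n K′) e)
      ; adj⇒  = λ K K′ a → adjacent⇒cyclic (toℕ<n K) (toℕ<n K′) a
      ; ⇒adj  = λ K K′ → cyclic⇒adjacent (toℕ<n K′) (toℕ<n K)
      }
      where
        CycAdjℕ : ℕ → ℕ → Set
        CycAdjℕ i j =
          suc i ≡ j ⊎ (suc j ≡ i ⊎ ((i ≡ 0 × suc j ≡ suc (suc n)) ⊎ (j ≡ 0 × suc i ≡ suc (suc n))))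

        adjacent⇒cyclic : ∀ {i j} → i < suc (suc n) → j < suc (suc n) → q i ∼ q j → CycAdjℕ i j
        adjacent⇒cyclic i< j< a with snoc-adjacent i< j< a
        ... | inj₁ (inj₁ e) = inj₁ e
        ... | inj₁ (inj₂ e) = inj₂ (inj₁ e)
        ... | inj₂ (inj₁ (refl , j<′ , v∼pⱼ)) with only-ends _ j<′ v∼pⱼ
        ...   | inj₁ j≡0  = inj₂ (inj₂ (inj₂ (j≡0 , refl)))
        ...   | inj₂ refl = inj₂ (inj₁ refl)
        adjacent⇒cyclic i< j< a | inj₂ (inj₂ (refl , i<′ , v∼pᵢ)) with only-ends _ i<′ v∼pᵢ
        ...   | inj₁ i≡0  = inj₂ (inj₂ (inj₁ (i≡0 , refl)))
        ...   | inj₂ refl = inj₁ refl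

        successor-adjacent : ∀ {i j} → j < suc (suc n) → suc i ≡ j → q i ∼ q j
        successor-adjacent j< refl = snoc-linked v∼pₙ j<

        closing-adjacent : ∀ {i j} → i ≡ 0 → suc j ≡ suc (suc n) → q i ∼ q j
        closing-adjacent refl refl = subst (p 0 ∼_) (sym snoc-last) (~-sym G v∼p₀)

        cyclic⇒adjacent : ∀ {i j} → j < suc (suc n) → i < suc (suc n) → CycAdjℕ i j → q i ∼ q j
        cyclic⇒adjacent j< i< (inj₁ e)                       = successor-adjacent j< e
        cyclic⇒adjacent j< i< (inj₂ (inj₁ e))                = ~-sym G (successor-adjacent i< e)
        cyclic⇒adjacent j< i< (inj₂ (inj₂ (inj₁ (i≡0 , e)))) = closing-adjacent i≡0 e
        cyclic⇒adjacent j< i< (inj₂ (inj₂ (inj₂ (j≡0 , e)))) = ~-sym G (closing-adjacent j≡0 e)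

  HoleOfLength≤ : ℕ → Set
  HoleOfLength≤ N = ∃₂ λ M (h : Fin M → Vtx G) → IsHole G M h × M ≤ N

  HoleOfLength≤-mono : ∀ {N N′} → N ≤ N′ → HoleOfLength≤ N → HoleOfLength≤ N′
  HoleOfLength≤-mono N≤N′ (M , h , h-hole , M≤N) = M , h , h-hole , ≤-trans M≤N N≤N′

  close-by-edge : ∀ {n w u v} → IsInducedPath (suc n) w → 1 ≤ n →
    (∀ z → z < suc n → u ≢ w z) → (∀ z → z < suc n → v ≢ w z) → u ∼ v → u ∼ w 0 → v ∼ w n →
    (∀ z → z < suc n → u ∼ w z → z ≡ 0) → (∀ z → z < suc n → v ∼ w z → z ≡ n) →
    HoleOfLength≤ (3 + n)
  close-by-edge {n} {w} {u} {v} path 1≤n u-fresh v-fresh u∼v u∼w₀ v∼wₙ u-only-first v-only-last =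
    _ , _ , close-by-vertex path⁺ u-fresh⁺ (s≤s 1≤n) u∼w₀ u∼v⁺ u-only-ends , ≤-refl
    where
      w⁺ = snoc (suc n) w v
      path⁺ = snoc-induced path v-fresh v∼wₙ v-only-last
      u∼v⁺ = subst (u ∼_) (sym (snoc-last path v-fresh)) u∼v
      u-fresh⁺ : ∀ z → z < suc (suc n) → u ≢ w⁺ z
      u-fresh⁺ z z< with snoc-view w v z<
      ... | inj₁ (z<′ , e) = λ u≡ → u-fresh z z<′ (trans u≡ e)
      ... | inj₂ (_ , e)   = λ u≡ → ~-irr G (subst (u ∼_) (sym (trans u≡ e)) u∼v)
      u-only-ends : ∀ z → z < suc (suc n) → u ∼ w⁺ z → z ≡ 0 ⊎ z ≡ suc n
      u-only-ends z z< a with snoc-view w v z<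
      ... | inj₁ (z<′ , e) = inj₁ (u-only-first z z<′ (subst (u ∼_) e a))
      ... | inj₂ (z≡ , _)  = inj₂ z≡

  neighbour? : ∀ u (p : ℕ → Vtx G) → Decidable (λ z → u ∼ p z)
  neighbour? u p z = ~-dec G u (p z)

  vertex-detour-hole : ∀ {d p u g} → IsInducedPath (suc d) p → (∀ z → z < suc d → u ≢ p z) →
    u ∼ p 0 → u ∼ p d → 0 < g → g < d → ¬ u ∼ p g → HoleOfLength≤ (2 + d)
  vertex-detour-hole {d} {p} {u} {g} path fresh u∼p₀ u∼p_d 0<g g<d u≁p_g
    with greatest-witness (neighbour? u p) g u∼p₀ | least-witness (neighbour? u p) (<⇒≤ g<d) u∼p_d
  ... | x , x≤g , u∼pₓ , none-in-x,g] | y , g≤y , y≤d , u∼pᵧ , none-in-[g,y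
    with m≤n⇒∃[o]m+o≡n (≤-trans x≤g g≤y)
  ... | e , refl = _ , _ , close-by-vertex window window-fresh 2≤e u∼pₓ₊₀ u∼pᵧ only-ends , s≤s (s≤s e≤d)
    where
      x<g : x < g
      x<g = ≤∧≢⇒< x≤g (λ { refl → u≁p_g u∼pₓ })
      g<y : g < x + e
      g<y = ≤∧≢⇒< g≤y (λ { refl → u≁p_g u∼pᵧ })
      window : IsInducedPath (suc e) (λ z → p (x + z))
      window = segment x (subst (_≤ suc d) (sym (+-suc x e)) (s≤s y≤d)) path
      window-fresh : ∀ z → z < suc e → u ≢ p (x + z)
      window-fresh z z≤e = fresh (x + z) (s≤s (≤-trans (+-monoʳ-≤ x (≤-pred z≤e)) y≤d))
      2≤e : 2 ≤ e
      2≤e = +-cancelˡ-≤ x 2 e (subst (_≤ x + e) (+-comm 2 x) (≤-trans (s≤s x<g) g<y))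
      e≤d : e ≤ d
      e≤d = ≤-trans (m≤n+m e x) y≤d
      u∼pₓ₊₀ : u ∼ p (x + 0)
      u∼pₓ₊₀ = subst (λ t → u ∼ p t) (sym (+-identityʳ x)) u∼pₓ
      only-ends : ∀ z → z < suc e → u ∼ p (x + z) → z ≡ 0 ⊎ z ≡ e
      only-ends zero    _   _ = inj₁ refl
      only-ends (suc z) z<e a with m≤n⇒m<n∨m≡n (≤-pred z<e) | ≤-total (x + suc z) g
      ... | inj₂ e≡     | _         = inj₂ e≡
      ... | inj₁ _      | inj₁ left = contradiction a (none-in-x,g] (x + suc z) (m<m+n x z<s) left)
      ... | inj₁ 1+z<e  | inj₂ right =
        contradiction a (none-in-[g,y (x + suc z) right (+-monoʳ-< x 1+z<e))

  edge-detour-hole : ∀ {d p u v} → IsInducedPath (suc d) p →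
    (∀ z → z < suc d → u ≢ p z) → (∀ z → z < suc d → v ≢ p z) → u ∼ v → u ∼ p 0 → v ∼ p d →
    (∀ z → z < suc d → ¬ (u ∼ p z × v ∼ p z)) → HoleOfLength≤ (3 + d)
  edge-detour-hole {d} {p} {u} {v} path u-fresh v-fresh u∼v u∼p₀ v∼p_d no-common
    with least-witness (neighbour? v p) z≤n v∼p_d
  ... | y , _ , y≤d , v∼pᵧ , v-none-before-y with greatest-witness (neighbour? u p) y u∼p₀
  ... | x , x≤y , u∼pₓ , u-none-in-x,y] with m≤n⇒∃[o]m+o≡n x≤y
  ... | e , refl = HoleOfLength≤-mono (+-monoʳ-≤ 3 (≤-trans (m≤n+m e x) y≤d))
    (close-by-edge window 1≤e (λ z z< → u-fresh (x + z) (bounded z<))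
       (λ z z< → v-fresh (x + z) (bounded z<)) u∼v u∼pₓ₊₀ v∼pᵧ u-only-first v-only-last)
    where
      window : IsInducedPath (suc e) (λ z → p (x + z))
      window = segment x (subst (_≤ suc d) (sym (+-suc x e)) (s≤s y≤d)) path
      bounded : ∀ {z} → z < suc e → x + z < suc d
      bounded z< = s≤s (≤-trans (+-monoʳ-≤ x (≤-pred z<)) y≤d)
      1≤e : 1 ≤ e
      1≤e = n≢0⇒n>0 λ { refl → no-common x (s≤s (≤-trans x≤y y≤d))
                                  (u∼pₓ , subst (λ t → v ∼ p t) (+-identityʳ x) v∼pᵧ) }
      u∼pₓ₊₀ : u ∼ p (x + 0)
      u∼pₓ₊₀ = subst (λ t → u ∼ p t) (sym (+-identityʳ x)) u∼pₓ
      u-only-first : ∀ z → z < suc e → u ∼ p (x + z) → z ≡ 0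
      u-only-first zero    _  _ = refl
      u-only-first (suc z) z< a =
        contradiction a (u-none-in-x,y] (x + suc z) (m<m+n x z<s) (+-monoʳ-≤ x (≤-pred z<)))
      v-only-last : ∀ z → z < suc e → v ∼ p (x + z) → z ≡ e
      v-only-last z z< a with m≤n⇒m<n∨m≡n (≤-pred z<)
      ... | inj₁ z<e = contradiction a (v-none-before-y (x + z) z≤n (+-monoʳ-< x z<e))
      ... | inj₂ z≡e = z≡e

-- Positions on a cycle of length L

module CyclicPositions (L : ℕ) {{_ : NonZero L}} where

  advance : Fin L → ℕ → Fin L
  advance w z = (toℕ w + z) mod L

  congruent-below-equal : ∀ {a b} n₁ n₂ → a < L → b < L → a + n₁ * L ≡ b + n₂ * L → a ≡ b
  congruent-below-equal {a} {b} n₁ n₂ a<L b<L e = begin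
    a                ≡⟨ m<n⇒m%n≡m a<L ⟨
    a % L            ≡⟨ [m+kn]%n≡m%n a n₁ L ⟨
    (a + n₁ * L) % L ≡⟨ cong (_% L) e ⟩
    (b + n₂ * L) % L ≡⟨ [m+kn]%n≡m%n b n₂ L ⟩
    b % L            ≡⟨ m<n⇒m%n≡m b<L ⟩
    b                ∎
    where open ≡-Reasoning

  fwd<L : ∀ x y → fwd L x y < L
  fwd<L x y with toℕ x ≤ᵇ toℕ y | ≤ᵇ-reflects-≤ (toℕ x) (toℕ y)
  ... | true  | ofʸ _   = ≤-<-trans (m∸n≤m (toℕ y) (toℕ x)) (toℕ<n y)
  ... | false | ofⁿ x≰y =
    <-of-common-offset (m+[n∸m]≡n x≤y+L) refl (+-monoˡ-< L (≰⇒> x≰y))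
    where x≤y+L = ≤-trans (<⇒≤ (toℕ<n x)) (m≤n+m L (toℕ y))

  fwd-congruent : ∀ x y → ∃ λ δ → toℕ x + fwd L x y ≡ toℕ y + δ * L
  fwd-congruent x y with toℕ x ≤ᵇ toℕ y | ≤ᵇ-reflects-≤ (toℕ x) (toℕ y)
  ... | true  | ofʸ x≤y = 0 , trans (m+[n∸m]≡n x≤y) (sym (+-identityʳ _))
  ... | false | ofⁿ _   = 1 , trans (m+[n∸m]≡n x≤y+L) (cong (toℕ y +_) (sym (+-identityʳ L)))
    where x≤y+L = ≤-trans (<⇒≤ (toℕ<n x)) (m≤n+m L (toℕ y))

  congruences-cancel : ∀ x y d f n₁ n₂ δ → x + n₁ * L + d ≡ y + n₂ * L → x + f ≡ y + δ * L →
    f + n₂ * L ≡ d + (n₁ + δ) * L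
  congruences-cancel x y d f n₁ n₂ δ e e′ = +-cancelˡ-≡ x _ _ (begin
    x + (f + n₂ * L)       ≡⟨ +-assoc x f (n₂ * L) ⟨
    x + f + n₂ * L         ≡⟨ cong (_+ n₂ * L) e′ ⟩
    y + δ * L + n₂ * L     ≡⟨ solve (y ∷ δ ∷ n₂ ∷ L ∷ []) ⟩
    y + n₂ * L + δ * L     ≡⟨ cong (_+ δ * L) e ⟨
    x + n₁ * L + d + δ * L ≡⟨ solve (x ∷ d ∷ n₁ ∷ δ ∷ L ∷ []) ⟩
    x + (d + (n₁ + δ) * L) ∎)
    where open ≡-Reasoning

  fwd-unique : ∀ {x y d} n₁ n₂ → toℕ x + n₁ * L + d ≡ toℕ y + n₂ * L → d < L → fwd L x y ≡ d
  fwd-unique {x} {y} n₁ n₂ e d<L with fwd-congruent x y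
  ... | δ , e′ =
    congruent-below-equal n₂ (n₁ + δ) (fwd<L x y) d<L (congruences-cancel _ _ _ _ n₁ n₂ δ e e′)

  fwd-self : ∀ x → fwd L x x ≡ 0
  fwd-self x = fwd-unique {x} {x} 0 0 (+-identityʳ _) (>-nonZero⁻¹ L)

  advance-fwd : ∀ w i → advance w (fwd L w i) ≡ i
  advance-fwd w i with fwd-congruent w i
  ... | δ , e = toℕ-injective (begin
    toℕ (advance w (fwd L w i)) ≡⟨ toℕ-fromℕ< _ ⟩
    (toℕ w + fwd L w i) % L     ≡⟨ cong (_% L) e ⟩
    (toℕ i + δ * L) % L         ≡⟨ [m+kn]%n≡m%n (toℕ i) δ L ⟩
    toℕ i % L                   ≡⟨ m<n⇒m%n≡m (toℕ<n i) ⟩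
    toℕ i                       ∎)
    where open ≡-Reasoning

  fwd-advance : ∀ w {z} → z < L → fwd L w (advance w z) ≡ z
  fwd-advance w {z} z<L = fwd-unique 0 ((toℕ w + z) / L) (begin
    toℕ w + 0 + z                           ≡⟨ cong (_+ z) (+-identityʳ (toℕ w)) ⟩
    toℕ w + z                               ≡⟨ m≡m%n+[m/n]*n (toℕ w + z) L ⟩
    (toℕ w + z) % L + (toℕ w + z) / L * L   ≡⟨ cong (_+ (toℕ w + z) / L * L) (toℕ-fromℕ< _) ⟨
    toℕ (advance w z) + (toℕ w + z) / L * L ∎) z<L
    where open ≡-Reasoning

  advance-zero : ∀ w → advance w 0 ≡ w
  advance-zero w = trans (cong (advance w) (sym (fwd-self w))) (advance-fwd w w)

  fwd-injective : ∀ w {i j} → fwd L w i ≡ fwd L w j → i ≡ j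
  fwd-injective w {i} {j} e =
    trans (sym (advance-fwd w i)) (trans (cong (advance w) e) (advance-fwd w j))

  fwd≡0⇒≡ : ∀ {w i} → fwd L w i ≡ 0 → w ≡ i
  fwd≡0⇒≡ {w} e = fwd-injective w (trans (fwd-self w) (sym e))

  fwd-split : ∀ w {x y} → fwd L w x ≤ fwd L w y → fwd L w x + fwd L x y ≡ fwd L w y
  fwd-split w {x} {y} a≤b with fwd-congruent w x | fwd-congruent w y
  ... | δ₁ , e₁ | δ₂ , e₂ = trans (cong (a +_) fwd-x-y) (m+[n∸m]≡n a≤b)
    where
      open ≡-Reasoning
      a = fwd L w x
      b = fwd L w y
      fwd-x-y : fwd L x y ≡ b ∸ a
      fwd-x-y = fwd-unique δ₁ δ₂ (begin
        toℕ x + δ₁ * L + (b ∸ a) ≡⟨ cong (_+ (b ∸ a)) e₁ ⟨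
        toℕ w + a + (b ∸ a)      ≡⟨ +-assoc (toℕ w) a (b ∸ a) ⟩
        toℕ w + (a + (b ∸ a))    ≡⟨ cong (toℕ w +_) (m+[n∸m]≡n a≤b) ⟩
        toℕ w + b                ≡⟨ e₂ ⟩
        toℕ y + δ₂ * L           ∎) (≤-<-trans (m∸n≤m b a) (fwd<L w y))

  fwd-wrap : ∀ w {x y} → fwd L w y < fwd L w x → fwd L w x + fwd L x y ≡ fwd L w y + L
  fwd-wrap w {x} {y} b<a with fwd-congruent w x | fwd-congruent w y
  ... | δ₁ , e₁ | δ₂ , e₂ = trans (cong (a +_) fwd-x-y) (m+[n∸m]≡n a≤b+L)
    where
      open ≡-Reasoning
      a = fwd L w x
      b = fwd L w y
      a≤b+L : a ≤ b + L
      a≤b+L = ≤-trans (<⇒≤ (fwd<L w x)) (m≤n+m L b)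
      fwd-x-y : fwd L x y ≡ b + L ∸ a
      fwd-x-y = fwd-unique δ₁ (suc δ₂) (begin
        toℕ x + δ₁ * L + (b + L ∸ a) ≡⟨ cong (_+ (b + L ∸ a)) e₁ ⟨
        toℕ w + a + (b + L ∸ a)      ≡⟨ +-assoc (toℕ w) a (b + L ∸ a) ⟩
        toℕ w + (a + (b + L ∸ a))    ≡⟨ cong (toℕ w +_) (m+[n∸m]≡n a≤b+L) ⟩
        toℕ w + (b + L)              ≡⟨ +-assoc (toℕ w) b L ⟨
        toℕ w + b + L                ≡⟨ cong (_+ L) e₂ ⟩
        toℕ y + δ₂ * L + L           ≡⟨ +-assoc (toℕ y) (δ₂ * L) L ⟩
        toℕ y + (δ₂ * L + L)         ≡⟨ cong (toℕ y +_) (+-comm (δ₂ * L) L) ⟩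
        toℕ y + suc δ₂ * L           ∎)
        (<-of-common-offset (m+[n∸m]≡n a≤b+L) refl (+-monoˡ-< L b<a))

  fwd-cycle : ∀ {x y} → x ≢ y → fwd L x y + fwd L y x ≡ L
  fwd-cycle {x} {y} x≢y = begin
    fwd L x y + fwd L y x ≡⟨ +-comm (fwd L x y) _ ⟩
    fwd L y x + fwd L x y ≡⟨ fwd-wrap y (subst (_< fwd L y x) (sym (fwd-self y)) 0<fwd-y-x) ⟩
    fwd L y y + L         ≡⟨ cong (_+ L) (fwd-self y) ⟩
    L                     ∎
    where
      open ≡-Reasoning
      0<fwd-y-x = n≢0⇒n>0 (λ e → x≢y (sym (fwd≡0⇒≡ e)))

  successor⇒fwd≡1 : 1 < L → ∀ {x y} n → suc (toℕ x) ≡ toℕ y + n * L → fwd L x y ≡ 1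
  successor⇒fwd≡1 1<L n e =
    fwd-unique 0 n (trans (cong (_+ 1) (+-identityʳ _)) (trans (+-comm _ 1) e)) 1<L

  cyclic-adjacent⇒fwd≡1 : 1 < L → ∀ {i j} → CycAdj L i j → fwd L i j ≡ 1 ⊎ fwd L j i ≡ 1
  cyclic-adjacent⇒fwd≡1 1<L (inj₁ e)        = inj₁ (successor⇒fwd≡1 1<L 0 (trans e (sym (+-identityʳ _))))
  cyclic-adjacent⇒fwd≡1 1<L (inj₂ (inj₁ e)) = inj₂ (successor⇒fwd≡1 1<L 0 (trans e (sym (+-identityʳ _))))
  cyclic-adjacent⇒fwd≡1 1<L (inj₂ (inj₂ (inj₁ (i≡0 , e)))) =
    inj₂ (successor⇒fwd≡1 1<L 1 (trans e (sym (trans (cong (_+ 1 * L) i≡0) (+-identityʳ L)))))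
  cyclic-adjacent⇒fwd≡1 1<L (inj₂ (inj₂ (inj₂ (j≡0 , e)))) =
    inj₁ (successor⇒fwd≡1 1<L 1 (trans e (sym (trans (cong (_+ 1 * L) j≡0) (+-identityʳ L)))))

  fwd≡1⇒cyclic-adjacent : ∀ {i j} → fwd L i j ≡ 1 → CycAdj L i j
  fwd≡1⇒cyclic-adjacent {i} {j} f≡1 with fwd-congruent i j
  ... | δ , e with trans (+-comm 1 (toℕ i)) (trans (cong (toℕ i +_) (sym f≡1)) e)
  ... | 1+i≡ with δ
  ...   | zero     = inj₁ (trans 1+i≡ (+-identityʳ _))
  ...   | suc zero =
    inj₂ (inj₂ (inj₂ (j≡0 , trans 1+i≡ (trans (cong (_+ (L + 0)) j≡0) (+-identityʳ L)))))
    where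
      j+L≤L : toℕ j + L ≤ 0 + L
      j+L≤L = subst (_≤ L) (trans 1+i≡ (cong (toℕ j +_) (+-identityʳ L))) (toℕ<n i)
      j≡0 : toℕ j ≡ 0
      j≡0 = n≤0⇒n≡0 (+-cancelʳ-≤ L (toℕ j) 0 j+L≤L)
  ...   | suc (suc δ′) = contradiction (≤-<-trans (toℕ<n i) L<) (<-irrefl 1+i≡)
    where
      L< : L < toℕ j + (L + (L + δ′ * L))
      L< = <-≤-trans (m<m+n L (>-nonZero⁻¹ L))
             (≤-trans (+-monoʳ-≤ L (m≤m+n L (δ′ * L))) (m≤n+m _ (toℕ j)))

  Between : Fin L → Fin L → Fin L → Set
  Between x y z = 0 < fwd L x y × fwd L x y < fwd L x z

  between⇒2≤fwd : ∀ {x y z} → Between x y z → 2 ≤ fwd L x z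
  between⇒2≤fwd (0<y , y<z) = ≤-trans (s≤s 0<y) y<z

  ordered⇒between : ∀ m {α γ β} → 0 < fwd L m α → fwd L m α < fwd L m γ → fwd L m γ < fwd L m β →
    Between α γ β × Between β m α
  ordered⇒between m {α} {γ} {β} 0<α α<γ γ<β =
    (<-of-common-offset (+-identityʳ _) α+αγ α<γ , <-of-common-offset α+αγ α+αβ γ<β) ,
    (<-of-common-offset (+-identityʳ _) β+βm (fwd<L m β) , <-of-common-offset β+βm β+βα (+-monoˡ-< L 0<α))
    where
      α<β = <-trans α<γ γ<β
      α+αγ = fwd-split m (<⇒≤ α<γ)
      α+αβ = fwd-split m (<⇒≤ α<β)
      m<β : fwd L m m < fwd L m β
      m<β = subst (_< fwd L m β) (sym (fwd-self m)) (<-trans 0<α α<β)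
      β+βm : fwd L m β + fwd L β m ≡ L
      β+βm = trans (fwd-wrap m m<β) (cong (_+ L) (fwd-self m))
      β+βα = fwd-wrap m α<β

  Arc? : ∀ x y → Decidable (Arc L x y)
  Arc? x y i = fwd L x i ≤? fwd L x y

  start∈Arc : ∀ x y → Arc L x y x
  start∈Arc x y = subst (_≤ fwd L x y) (sym (fwd-self x)) z≤n

  end∈Arc : ∀ x y → Arc L x y y
  end∈Arc x y = ≤-refl

  within⇒Arc : ∀ m {x y i} → fwd L m x ≤ fwd L m i → fwd L m i ≤ fwd L m y → Arc L x y i
  within⇒Arc m x≤i i≤y = ≤-of-common-offset (fwd-split m x≤i) (fwd-split m (≤-trans x≤i i≤y)) i≤y

  outside⇒opposite-Arc : ∀ m {x y i} → fwd L m x < fwd L m y →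
    fwd L m i ≤ fwd L m x ⊎ fwd L m y ≤ fwd L m i → Arc L y x i
  outside⇒opposite-Arc m x<y (inj₁ i≤x) =
    ≤-of-common-offset (fwd-wrap m (≤-<-trans i≤x x<y)) (fwd-wrap m x<y) (+-monoˡ-≤ L i≤x)
  outside⇒opposite-Arc m {i = i} x<y (inj₂ y≤i) =
    ≤-of-common-offset (fwd-split m y≤i) (fwd-wrap m x<y) (≤-trans (<⇒≤ (fwd<L m i)) (m≤n+m L _))

-- Vertices and edges near a shortest hole

module _ (G : Graph) {L : ℕ} (c : Fin L → Vtx G) where

  InC? : Decidable (InC G c)
  InC? u = any? (λ i → c i Fin.≟ u)

  InD? : Decidable (InD G c)
  InD? u = all? (λ i → ~-dec G u (c i))

  Z? : ∀ i → Decidable (Z G c i)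
  Z? i u = (u Fin.≟ c i) ⊎-dec (~-dec G u (c i) ×-dec ¬? (InC? u) ×-dec ¬? (InD? u))

  ZS? : ∀ {S} → Decidable S → Decidable (ZS G c S)
  ZS? S? u = any? (λ i → S? i ×-dec Z? i u)

  Z-of-InNbd : ∀ {u} → InNbd G c u → ∃ λ i → Z G c i u
  Z-of-InNbd (inj₁ (i , cᵢ≡u) , _) = i , inj₁ (sym cᵢ≡u)
  Z-of-InNbd {u} (inj₂ (i , u∼cᵢ) , u∉D) with InC? u
  ... | yes (i′ , cᵢ′≡u) = i′ , inj₁ (sym cᵢ′≡u)
  ... | no u∉C           = i , inj₂ (u∼cᵢ , u∉C , u∉D)

  ≁-of-¬Z : ∀ {u i} → ¬ InC G c u → ¬ InD G c u → ¬ Z G c i u → ¬ _~_ G u (c i)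
  ≁-of-¬Z u∉C u∉D ¬Zᵢ u∼cᵢ = ¬Zᵢ (inj₂ (u∼cᵢ , u∉C , u∉D))

module _ (G : Graph) {L : ℕ} {{_ : NonZero L}} (c : Fin L → Vtx G) (hole : IsHole G L c) where

  open Graph G using () renaming (_~_ to _∼_)
  open CyclicPositions L

  private
    1<L : 1 < L
    1<L = ≤-trans (s≤s (s≤s z≤n)) (IsHole.len≥4 hole)

  arc-induced : ∀ α {d} → 2 + d ≤ L → IsInducedPath G (suc d) (λ z → c (advance α z))
  arc-induced α {d} 2+d≤L = record
    { injective = λ i< j< e →
        trans (sym (offset i<)) (trans (cong (fwd L α) (IsHole.inj hole e)) (offset j<))
    ; linked    = λ 1+i< → IsHole.⇒adj hole _ _ (fwd≡1⇒cyclic-adjacent (fwd-step 1+i<))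
    ; chordless = λ i< j< a → Data.Sum.map (consecutive i< j<) (consecutive j< i<)
                                (cyclic-adjacent⇒fwd≡1 1<L (IsHole.adj⇒ hole _ _ a))
    }
    where
      open ≡-Reasoning

      offset : ∀ {z} → z < suc d → fwd L α (advance α z) ≡ z
      offset z< = fwd-advance α (<-trans z< 2+d≤L)

      offset-≤ : ∀ {i j} → i < suc d → j < suc d → i ≤ j → fwd L α (advance α i) ≤ fwd L α (advance α j)
      offset-≤ i< j< = subst₂ _≤_ (sym (offset i<)) (sym (offset j<))

      fwd-step : ∀ {i} → suc i < suc d → fwd L (advance α i) (advance α (suc i)) ≡ 1
      fwd-step {i} 1+i< = +-cancelˡ-≡ i _ _ (begin
        i + f                       ≡⟨ cong (_+ f) (offset i<) ⟨
        fwd L α (advance α i) + f   ≡⟨ fwd-split α (offset-≤ i< 1+i< (n≤1+n i)) ⟩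
        fwd L α (advance α (suc i)) ≡⟨ trans (offset 1+i<) (+-comm 1 i) ⟩
        i + 1                       ∎)
        where
          i< = <-trans (n<1+n i) 1+i<
          f = fwd L (advance α i) (advance α (suc i))

      consecutive : ∀ {i j} → i < suc d → j < suc d → fwd L (advance α i) (advance α j) ≡ 1 → suc i ≡ j
      consecutive {i} {j} i< j< f≡1 with i ≤? j
      ... | yes i≤j = begin
        suc i                                                     ≡⟨ +-comm 1 i ⟩
        i + 1                                                     ≡⟨ cong₂ _+_ (offset i<) f≡1 ⟨
        fwd L α (advance α i) + fwd L (advance α i) (advance α j) ≡⟨ fwd-split α (offset-≤ i< j< i≤j) ⟩
        fwd L α (advance α j)                                     ≡⟨ offset j< ⟩
        j                                                         ∎
      ... | no i≰j = contradiction (≤-trans L≤1+i (s≤s (≤-pred i<))) (<⇒≱ 2+d≤L)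
        where
          j<ᵃi : fwd L α (advance α j) < fwd L α (advance α i)
          j<ᵃi = subst₂ _<_ (sym (offset j<)) (sym (offset i<)) (≰⇒> i≰j)
          L≤1+i : L ≤ suc i
          L≤1+i = ≤-trans (m≤n+m L j) (≤-reflexive (begin
            j + L                                                     ≡⟨ cong (_+ L) (offset j<) ⟨
            fwd L α (advance α j) + L                                 ≡⟨ fwd-wrap α j<ᵃi ⟨
            fwd L α (advance α i) + fwd L (advance α i) (advance α j) ≡⟨ cong₂ _+_ (offset i<) f≡1 ⟩
            i + 1                                                     ≡⟨ +-comm i 1 ⟩
            suc i                                                     ∎))

  separated-nonadjacent : ∀ {α β γ δ} → Between α γ β → Between β δ α → ¬ c α ∼ c β
  separated-nonadjacent {α} {β} {γ} {δ} γ-inside δ-inside a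
    with cyclic-adjacent⇒fwd≡1 1<L (IsHole.adj⇒ hole _ _ a)
  ... | inj₁ e = contradiction (subst (2 ≤_) e (between⇒2≤fwd {α} {γ} {β} γ-inside)) λ { (s≤s ()) }
  ... | inj₂ e = contradiction (subst (2 ≤_) e (between⇒2≤fwd {β} {δ} {α} δ-inside)) λ { (s≤s ()) }

  module _ (shortest : ∀ L′ c′ → IsHole G L′ c′ → L ≤ L′) where

    hole-length-bound : ∀ {N} → HoleOfLength≤ G N → L ≤ N
    hole-length-bound (M , h , h-hole , M≤N) = ≤-trans (shortest M h h-hole) M≤N

    private
      off-C : ∀ {v} → ¬ InC G c v → ∀ z → v ≢ c z
      off-C v∉C z e = v∉C (z , sym e)

      via-arc : ∀ {v} α i → v ∼ c i → v ∼ c (advance α (fwd L α i))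
      via-arc {v} α i = subst (λ t → v ∼ c t) (sym (advance-fwd α i))

      arc-start : ∀ {v} α → v ∼ c α → v ∼ c (advance α 0)
      arc-start {v} α = subst (λ t → v ∼ c t) (sym (advance-zero α))

    vertex-arc-bound : ∀ {v α β γ} → ¬ InC G c v → v ∼ c α → v ∼ c β → ¬ v ∼ c γ →
      Between α γ β → L ≤ 2 + fwd L α β
    vertex-arc-bound {v} {α} {β} {γ} v∉C v∼α v∼β v≁γ (0<γ , γ<β) with L ≤? 2 + fwd L α β
    ... | yes L≤ = L≤
    ... | no  L≰ = hole-length-bound (vertex-detour-hole G (arc-induced α (<⇒≤ (≰⇒> L≰)))
                     (λ z _ → off-C v∉C _) (arc-start α v∼α) (via-arc α β v∼β) 0<γ γ<β
                     (v≁γ ∘ subst (λ t → v ∼ c t) (advance-fwd α γ)))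

    edge-arc-bound : ∀ {u v α β} → u ∼ v → ¬ InC G c u → ¬ InC G c v → u ∼ c α → v ∼ c β →
      (∀ i → ¬ (u ∼ c i × v ∼ c i)) → L ≤ 3 + fwd L α β
    edge-arc-bound {α = α} {β} u∼v u∉C v∉C u∼α v∼β no-common with L ≤? 3 + fwd L α β
    ... | yes L≤ = L≤
    ... | no  L≰ = hole-length-bound (edge-detour-hole G (arc-induced α (<⇒≤ (<⇒≤ (≰⇒> L≰))))
                     (λ z _ → off-C u∉C _) (λ z _ → off-C v∉C _) u∼v
                     (arc-start α u∼α) (via-arc α β v∼β) (λ z _ → no-common _))

    straddling-vertex⇒L≤4 : ∀ m {v α γ β} → ¬ InC G c v →
      v ∼ c α → v ∼ c β → ¬ v ∼ c γ → ¬ v ∼ c m → fwd L m α < fwd L m γ → fwd L m γ < fwd L m β → L ≤ 4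
    straddling-vertex⇒L≤4 m {v} {α} v∉C v∼α v∼β v≁γ v≁m α<γ γ<β
      with ordered⇒between m 0<α α<γ γ<β
      where
        0<α : 0 < fwd L m α
        0<α = n≢0⇒n>0 (λ e → v≁m (subst (λ t → v ∼ c t) (sym (fwd≡0⇒≡ e)) v∼α))
    ... | γ-inside , m-inside = ≤-halves {k = 2} (fwd-cycle α≢β)
          (vertex-arc-bound v∉C v∼α v∼β v≁γ γ-inside) (vertex-arc-bound v∉C v∼β v∼α v≁m m-inside)
      where
        α≢β = λ e → <-irrefl (cong (fwd L m) e) (<-trans α<γ γ<β)

    straddling-edge⇒L≤6 : ∀ m {u v α γ β} → u ∼ v → ¬ InC G c u → ¬ InC G c v →
      u ∼ c α → v ∼ c β → ¬ u ∼ c γ → ¬ v ∼ c γ → ¬ u ∼ c m → ¬ v ∼ c m →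
      fwd L m α < fwd L m γ → fwd L m γ < fwd L m β → L ≤ 6
    straddling-edge⇒L≤6 m {u} {v} {α} {γ} {β} u∼v u∉C v∉C u∼α v∼β u≁γ v≁γ u≁m v≁m α<γ γ<β
      with L ≤? 4
    ... | yes L≤4 = ≤-trans L≤4 (m≤m+n 4 2)
    ... | no  L≰4 = ≤-halves {k = 3} (fwd-cycle α≢β)
          (edge-arc-bound u∼v u∉C v∉C u∼α v∼β no-common)
          (edge-arc-bound (~-sym G u∼v) v∉C u∉C v∼β u∼α (λ i → no-common i ∘ Data.Product.swap))
      where
        α≢β = λ e → <-irrefl (cong (fwd L m) e) (<-trans α<γ γ<β)
        no-common : ∀ i → ¬ (u ∼ c i × v ∼ c i)
        no-common i (u∼i , v∼i) with <-cmp (fwd L m i) (fwd L m γ)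
        ... | tri< i<γ _ _ = L≰4 (straddling-vertex⇒L≤4 m v∉C v∼i v∼β v≁γ v≁m i<γ γ<β)
        ... | tri≈ _ i≈γ _ = u≁γ (subst (λ t → u ∼ c t) (fwd-injective m i≈γ) u∼i)
        ... | tri> _ _ γ<i = L≰4 (straddling-vertex⇒L≤4 m u∉C u∼α u∼i u≁γ u≁m α<γ γ<i)

    crossing-edge⇒L≤6 : ∀ m {u v α γ β} → u ∼ v → Z G c α u → Z G c β v →
      ¬ Z G c m u → ¬ Z G c m v → ¬ Z G c γ u → ¬ Z G c γ v →
      fwd L m α < fwd L m γ → fwd L m γ < fwd L m β → L ≤ 6
    crossing-edge⇒L≤6 m u∼v (inj₁ refl) (inj₁ refl) ¬Zₘu _ _ _ α<γ γ<β
      with ordered⇒between m (n≢0⇒n>0 λ e → ¬Zₘu (inj₁ (cong c (sym (fwd≡0⇒≡ e))))) α<γ γ<β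
    ... | γ-inside , m-inside = contradiction u∼v (separated-nonadjacent γ-inside m-inside)
    crossing-edge⇒L≤6 m u∼v (inj₁ refl) (inj₂ (v∼β , v∉C , v∉D)) _ ¬Zₘv _ ¬Zᵧv α<γ γ<β =
      ≤-trans (straddling-vertex⇒L≤4 m v∉C (~-sym G u∼v) v∼β
                 (≁-of-¬Z G c v∉C v∉D ¬Zᵧv) (≁-of-¬Z G c v∉C v∉D ¬Zₘv) α<γ γ<β)
              (m≤m+n 4 2)
    crossing-edge⇒L≤6 m u∼v (inj₂ (u∼α , u∉C , u∉D)) (inj₁ refl) ¬Zₘu _ ¬Zᵧu _ α<γ γ<β =
      ≤-trans (straddling-vertex⇒L≤4 m u∉C u∼α u∼v
                 (≁-of-¬Z G c u∉C u∉D ¬Zᵧu) (≁-of-¬Z G c u∉C u∉D ¬Zₘu) α<γ γ<β)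
              (m≤m+n 4 2)
    crossing-edge⇒L≤6 m u∼v (inj₂ (u∼α , u∉C , u∉D)) (inj₂ (v∼β , v∉C , v∉D))
                      ¬Zₘu ¬Zₘv ¬Zᵧu ¬Zᵧv α<γ γ<β =
      straddling-edge⇒L≤6 m u∼v u∉C v∉C u∼α v∼β
        (≁-of-¬Z G c u∉C u∉D ¬Zᵧu) (≁-of-¬Z G c v∉C v∉D ¬Zᵧv)
        (≁-of-¬Z G c u∉C u∉D ¬Zₘu) (≁-of-¬Z G c v∉C v∉D ¬Zₘv) α<γ γ<β

    -- Paths in G_nbd avoiding Z_m

    module _ (7≤L : 7 ≤ L) (m : Fin L) {ℓ : ℕ} {q : Fin (suc ℓ) → Vtx G}
             (in-nbd : ∀ j → InNbd G c (q j)) (misses-m : ∀ j → ¬ Z G c m (q j)) where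

      private
        L≰6 : ¬ L ≤ 6
        L≰6 = <⇒≱ 7≤L

      -- Q indexed by ℕ; indices beyond ℓ wrap around and are never used.
      vertex : ℕ → Vtx G
      vertex t = q (t mod suc ℓ)

      vertex-toℕ : ∀ j → vertex (toℕ j) ≡ q j
      vertex-toℕ j = cong q (toℕ-injective (trans (toℕ-fromℕ< _) (m<n⇒m%n≡m (toℕ<n j))))

      vertex-linked : IsPath G ℓ q → ∀ {t} → t < ℓ → vertex t ∼ vertex (suc t)
      vertex-linked path {t} t<ℓ =
        subst₂ _∼_ (at (Fin.inject₁ f) (trans (toℕ-inject₁ f) (toℕ-fromℕ< t<ℓ)))
                   (at (Fin.suc f) (cong suc (toℕ-fromℕ< t<ℓ))) (IsPath.adj path f)
        where
          f = fromℕ< t<ℓ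
          at : ∀ j {t} → toℕ j ≡ t → q j ≡ vertex t
          at j refl = sym (vertex-toℕ j)

      place : ℕ → Fin L
      place t = proj₁ (Z-of-InNbd G c (in-nbd (t mod suc ℓ)))

      at-place : ∀ t → Z G c (place t) (vertex t)
      at-place t = proj₂ (Z-of-InNbd G c (in-nbd (t mod suc ℓ)))

      Interior : ℕ → Set
      Interior t = 0 < t × t < ℓ

      module _ (path : IsPath G ℓ q) {x y : Fin L} (x<y : fwd L m x < fwd L m y)
               (avoids : ∀ {t} → Interior t → ¬ Z G c x (vertex t) × ¬ Z G c y (vertex t)) where

        Inside : ℕ → Set
        Inside t = fwd L m x < fwd L m (place t) × fwd L m (place t) < fwd L m y

        same-side : ∀ {s t} → Interior s → Interior t → vertex s ∼ vertex t → Inside s → Inside t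
        same-side {s} {t} s-int t-int s∼t (x<s , s<y)
          with <-cmp (fwd L m (place t)) (fwd L m x) | <-cmp (fwd L m (place t)) (fwd L m y)
        ... | tri< t<x _ _ | _ = contradiction
              (crossing-edge⇒L≤6 m (~-sym G s∼t) (at-place t) (at-place s) (misses-m _) (misses-m _)
                 (proj₁ (avoids t-int)) (proj₁ (avoids s-int)) t<x x<s) L≰6
        ... | tri≈ _ t≈x _ | _ = contradiction
              (subst (λ i → Z G c i (vertex t)) (fwd-injective m t≈x) (at-place t)) (proj₁ (avoids t-int))
        ... | tri> _ _ x<t | tri< t<y _ _ = x<t , t<y
        ... | tri> _ _ _   | tri≈ _ t≈y _ = contradiction
              (subst (λ i → Z G c i (vertex t)) (fwd-injective m t≈y) (at-place t)) (proj₂ (avoids t-int))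
        ... | tri> _ _ _   | tri> _ _ y<t = contradiction
              (crossing-edge⇒L≤6 m s∼t (at-place s) (at-place t) (misses-m _) (misses-m _)
                 (proj₂ (avoids s-int)) (proj₂ (avoids t-int)) s<y y<t) L≰6

        inside-step : ∀ t → 1 ≤ t → suc t < ℓ → Inside t ⇔ Inside (suc t)
        inside-step t 1≤t 1+t<ℓ =
          mk⇔ (same-side t-int 1+t-int t∼1+t) (same-side 1+t-int t-int (~-sym G t∼1+t))
          where
            t-int   = 1≤t , <-trans (n<1+n t) 1+t<ℓ
            1+t-int = s≤s z≤n , 1+t<ℓ
            t∼1+t   = vertex-linked path (<-trans (n<1+n t) 1+t<ℓ)

        opposite-arcs-impossible : ∀ {s t} → Interior s → Interior t →
          ¬ Arc L x y (place s) → ¬ Arc L y x (place t) → ⊥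
        opposite-arcs-impossible {s} {t} (1≤s , s<ℓ) (1≤t , t<ℓ) s∉xy t∉yx =
          s∉xy (within⇒Arc m (<⇒≤ (proj₁ s-inside)) (<⇒≤ (proj₂ s-inside)))
          where
            t-inside : Inside t
            t-inside with fwd L m x <? fwd L m (place t) | fwd L m (place t) <? fwd L m y
            ... | yes x<t | yes t<y = x<t , t<y
            ... | yes _   | no t≮y  = contradiction (outside⇒opposite-Arc m x<y (inj₂ (≮⇒≥ t≮y))) t∉yx
            ... | no x≮t  | _       = contradiction (outside⇒opposite-Arc m x<y (inj₁ (≮⇒≥ x≮t))) t∉yx
            s-inside : Inside s
            s-inside = invariant-on-interval inside-step 1≤t t<ℓ 1≤s s<ℓ t-inside

      module _ {a b : Fin L} (ab-path : IsABPath G (Z G c a) (Z G c b) ℓ q) where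

        interior-avoids-ends : ∀ {t} → Interior t → ¬ Z G c a (vertex t) × ¬ Z G c b (vertex t)
        interior-avoids-ends {t} (0<t , t<ℓ) =
          subst (λ u → ¬ Z G c a u × ¬ Z G c b u) (trans (sym (vertex-toℕ j)) (cong vertex j≡t))
            (proj₂ (proj₂ (proj₂ ab-path)) j (subst (0 <_) (sym j≡t) 0<t) (subst (_< ℓ) (sym j≡t) t<ℓ))
          where
            j = fromℕ< (<-trans t<ℓ (n<1+n ℓ))
            j≡t = toℕ-fromℕ< (<-trans t<ℓ (n<1+n ℓ))

        uncovered-interior : ∀ {S} → S a → S b → ∀ j → ¬ ZS G c S (q j) → Interior (toℕ j)
        uncovered-interior a∈S b∈S j j∉ = n≢0⇒n>0 j≢0 , ≤∧≢⇒< (≤-pred (toℕ<n j)) j≢ℓ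
          where
            j≢0 : toℕ j ≢ 0
            j≢0 e = j∉ (a , a∈S , subst (λ i → Z G c a (q i)) (toℕ-injective {i = Fin.zero} (sym e))
                                    (proj₁ (proj₂ ab-path)))
            j≢ℓ : toℕ j ≢ ℓ
            j≢ℓ e = j∉ (b , b∈S , subst (λ i → Z G c b (q i))
                                    (toℕ-injective (trans (toℕ-fromℕ ℓ) (sym e))) (proj₁ (proj₂ (proj₂ ab-path))))

        uncovered-place : ∀ {S} j → ¬ ZS G c S (q j) → ¬ S (place (toℕ j))
        uncovered-place j j∉ s =
          j∉ (place (toℕ j) , s , subst (Z G c _) (vertex-toℕ j) (at-place (toℕ j)))

        covered? : ∀ x y → Decidable (λ j → ZS G c (Arc L x y) (q j))
        covered? x y j = ZS? G c (Arc? x y) (q j)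

        one-side : a ≢ b → (∀ j → ZS G c (Arc L a b) (q j)) ⊎ (∀ j → ZS G c (Arc L b a) (q j))
        one-side a≢b with all? (covered? a b) | all? (covered? b a)
        ... | yes covered | _           = inj₁ covered
        ... | no _        | yes covered = inj₂ covered
        ... | no ¬ab      | no ¬ba with ¬∀⟶∃¬ _ _ (covered? a b) ¬ab | ¬∀⟶∃¬ _ _ (covered? b a) ¬ba
        ... | j , j∉ | j′ , j′∉ with <-cmp (fwd L m a) (fwd L m b)
        ... | tri< a<b _ _ = ⊥-elim (opposite-arcs-impossible (proj₁ ab-path) a<b interior-avoids-ends
                               (uncovered-interior (start∈Arc a b) (end∈Arc a b) j j∉)
                               (uncovered-interior (end∈Arc b a) (start∈Arc b a) j′ j′∉)
                               (uncovered-place j j∉) (uncovered-place j′ j′∉))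
        ... | tri≈ _ a≈b _ = contradiction (fwd-injective m a≈b) a≢b
        ... | tri> _ _ b<a = ⊥-elim (opposite-arcs-impossible (proj₁ ab-path) b<a
                               (Data.Product.swap ∘ interior-avoids-ends)
                               (uncovered-interior (end∈Arc b a) (start∈Arc b a) j′ j′∉)
                               (uncovered-interior (start∈Arc a b) (end∈Arc a b) j j∉)
                               (uncovered-place j′ j′∉) (uncovered-place j j∉))

μ<L⇒7≤L : ∀ {k L} → MuLt k L → 7 ≤ L
μ<L⇒7≤L {k} (μ-bound , _) = ≤-trans (≤-trans (m≤m+n 7 1978) (m≤n+m 1985 (3217 * k)))
  (ℤ.drop‿+≤+ (ℤ.0≤i-j⇒j≤i (ℤ.≤-trans (ℤ.+≤+ z≤n) μ-bound)))

lemma4p6 : (G : Graph) (k : ℕ) → 1 ≤ k →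
    (L : ℕ) (c : Fin L → Vtx G) →
    IsShortestHole G L c →
    MuLt k L →
    ChordalOn G (λ v → ¬ InC G c v) →
    (a b : Fin L) → a ≢ b →
    (ℓ : ℕ) (q : Fin (suc ℓ) → Vtx G) →
    (∀ j → InNbd G c (q j)) →
    IsABPath G (Z G c a) (Z G c b) ℓ q →
    ¬ (∀ i → ∃ λ j → Z G c i (q j) ⊎ InD G c (q j)) →
    (∀ j → ZS G c (Arc L a b) (q j)) ⊎ (∀ j → ZS G c (Arc L b a) (q j))
lemma4p6 G _ _ L c (hole , shortest) μ<L _ a b a≢b _ q in-nbd ab-path not-spanning =
  one-side G c hole shortest (μ<L⇒7≤L μ<L) m in-nbd misses-m ab-path a≢b
  where
    instance
      L≢0 : NonZero L
      L≢0 = >-nonZero (≤-trans (s≤s z≤n) (IsHole.len≥4 hole))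

    Spanned : Fin L → Set
    Spanned i = ∃ λ j → Z G c i (q j) ⊎ InD G c (q j)

    unspanned : ∃ λ m → ¬ Spanned m
    unspanned = ¬∀⟶∃¬ L Spanned (λ i → any? (λ j → Z? G c i (q j) ⊎-dec InD? G c (q j)))
                  not-spanning

    m = proj₁ unspanned

    misses-m : ∀ j → ¬ Z G c m (q j)
    misses-m j in-Zₘ = proj₂ unspanned (j , inj₁ in-Zₘ)
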